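{- Let $G$ be a graph and $t$ a positive integer. If $G$ contains an odd $K_t$ minor, then for every integer $r\ge 1$ the $r$-level generalized Mycielskian $M_r(G)$ contains an odd $K_{t+1}$ minor.
   Context: The $r$-level generalized Mycielskian $M_r(G)$ has vertex set $V(G)\times\{0,1,\dots,r-1\}\cup\{z\}$ and edge set $$\bigl\{\{(u,i),(v,j)\}:\{u,v\}\in E(G)\text{ and }(|i-j|=1\text{ or }i=j=0)\bigr\}\cup\bigl\{\{(u,r-1),z\}:u\in V(G)\bigr\}.$$ An odd $K_m$ minor of a graph $H$ consists of $m$ pairwise vertex-disjoint trees $T_1,\dots,T_m$ that are subgraphs of $H$, together with a $2$-coloring of the vertices of these trees such that each $T_i$ is properly colored and for every pair $i\ne j$ there is an edge of $H$ between a vertex of $T_i$ and a vertex of $T_j$ having the same color. -}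

module Defs where

open import Data.Nat using (ℕ; zero; suc)
open import Data.Fin using (Fin; toℕ)
open import Data.Bool using (Bool)
open import Data.Product using (Σ; _×_; _,_; ∃)
open import Data.Sum using (_⊎_; inj₁; inj₂)
open import Data.Unit using (⊤; tt)
open import Data.Empty using (⊥)
open import Data.List using (List; []; _∷_; _++_; concatMap; allFin)
open import Data.List.Membership.Propositional using (_∈_)
open import Data.List.Relation.Unary.Unique.Propositional using (Unique)
open import Relation.Binary.PropositionalEquality using (_≡_; _≢_; sym)
open import Function.Bundles using (_↔_)

record Graph : Set₁ where
  field
    V     : Set
    E     : V → V → Set
    E-sym : ∀ {u v} → E u v → E v u
    E-irr : ∀ {u} → E u u → ⊥
open Graph public

Finite : Graph → Set
Finite G = Σ ℕ λ n → V G ↔ Fin n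

-- r-level generalized Mycielskian M_r(G)
-- vertices: V(G) × {0,…,r-1}  plus the apex z (inj₂ tt)

LevelAdj : ∀ {r} → Fin r → Fin r → Set
LevelAdj i j = (toℕ i ≡ suc (toℕ j)) ⊎ (toℕ j ≡ suc (toℕ i))

LevelOK : ∀ {r} → Fin r → Fin r → Set
LevelOK i j = LevelAdj i j ⊎ ((toℕ i ≡ 0) × (toℕ j ≡ 0))

MV : Graph → ℕ → Set
MV G r = (V G × Fin r) ⊎ ⊤

ME : (G : Graph) (r : ℕ) → MV G r → MV G r → Set
ME G r (inj₁ (u , i)) (inj₁ (v , j)) = E G u v × LevelOK i j
ME G r (inj₁ (u , i)) (inj₂ _)       = suc (toℕ i) ≡ r
ME G r (inj₂ _)       (inj₁ (v , j)) = suc (toℕ j) ≡ r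
ME G r (inj₂ _)       (inj₂ _)       = ⊥

private
  levelAdj-sym : ∀ {r} {i j : Fin r} → LevelAdj i j → LevelAdj j i
  levelAdj-sym (inj₁ p) = inj₂ p
  levelAdj-sym (inj₂ p) = inj₁ p

  levelOK-sym : ∀ {r} {i j : Fin r} → LevelOK i j → LevelOK j i
  levelOK-sym (inj₁ p) = inj₁ (levelAdj-sym p)
  levelOK-sym (inj₂ (p , q)) = inj₂ (q , p)

  ME-sym : (G : Graph) (r : ℕ) → ∀ {x y} → ME G r x y → ME G r y x
  ME-sym G r {inj₁ (u , i)} {inj₁ (v , j)} (e , l) = E-sym G e , levelOK-sym l
  ME-sym G r {inj₁ _} {inj₂ _} p = p
  ME-sym G r {inj₂ _} {inj₁ _} p = p
  ME-sym G r {inj₂ _} {inj₂ _} ()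

  ME-irr : (G : Graph) (r : ℕ) → ∀ {x} → ME G r x x → ⊥
  ME-irr G r {inj₁ _} (e , _) = E-irr G e
  ME-irr G r {inj₂ _} ()

Mycielskian : ℕ → Graph → Graph
Mycielskian r G = record
  { V = MV G r ; E = ME G r ; E-sym = ME-sym G r ; E-irr = ME-irr G r }

-- Rooted trees that are subgraphs of H (each child joined to its parent
-- by an edge of H).  Vertex-distinctness is imposed separately.

module _ (H : Graph) where

  data Tree : V H → Set where
    node : (v : V H) → List (Σ (V H) λ w → E H v w × Tree w) → Tree v

  mutual
    verts : ∀ {v} → Tree v → List (V H)
    verts (node v cs) = v ∷ vertsF cs

    vertsF : ∀ {v} → List (Σ (V H) λ w → E H v w × Tree w) → List (V H)
    vertsF [] = []
    vertsF ((w , _ , t) ∷ cs) = verts t ++ vertsF cs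

  mutual
    Proper : (V H → Bool) → ∀ {v} → Tree v → Set
    Proper c (node v cs) = ProperF c v cs

    ProperF : (V H → Bool) → (v : V H) → List (Σ (V H) λ w → E H v w × Tree w) → Set
    ProperF c v [] = ⊤
    ProperF c v ((w , _ , t) ∷ cs) = (c v ≢ c w) × Proper c t × ProperF c v cs

record OddMinor (H : Graph) (m : ℕ) : Set where
  field
    root     : Fin m → V H
    tree     : (i : Fin m) → Tree H (root i)
    -- the trees are vertex-disjoint (and genuinely trees: no repeated vertex)
    disjoint : Unique (concatMap (λ i → verts H (tree i)) (allFin m))
    colour   : V H → Bool
    proper   : (i : Fin m) → Proper H colour (tree i)
    link     : (i j : Fin m) → i ≢ j →
               Σ (V H) λ x → Σ (V H) λ y →
                 (x ∈ verts H (tree i)) × (y ∈ verts H (tree j)) ×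
                 E H x y × (colour x ≡ colour y)

module Submission where

-- For t = 1 the apex z and a top-level vertex form an odd K₂ minor (oddK₂).
-- For t ≥ 2 the branch trees T_i are kept on level 0, which is a copy of G
-- coloured as before, and {z} becomes a new branch set.  Every vertex of level
-- k ≥ 1 gets the colour shade s k (s flipped k times) and z gets shade s n.
-- Each T_i has an anchor: a vertex p of colour s with a neighbour q.  The
-- zigzag (p,0) (q,1) (p,2) … up to level n is grafted onto T_i at p; it is
-- properly coloured by the shades and its top is joined to z by an edge whose
-- ends both have shade n.  A T_i with an edge has an anchor inside itself; a
-- single-vertex T_i takes q in the next branch set via its monochromatic link,
-- which is why s is the common colour of the single-vertex branch sets.  Zigzags
-- of distinct trees are disjoint since their p's lie in different branch sets
-- and their q's do too (or have different colours).

open import Defs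
open import Data.Nat using (ℕ; zero; suc; _+_; _≤_; _<_; s≤s; z≤n)
open import Data.Nat.Properties using (+-suc; +-identityʳ; m<m+n; ≤-refl; <⇒≤; <⇒≢)
open import Data.Bool using (Bool; true; not)
open import Data.Bool.Properties using (¬-not; not-¬; not-injective) renaming (_≟_ to _≟ᵇ_)
open import Data.Fin using (Fin; zero; suc; toℕ; fromℕ; fromℕ<; punchIn)
open import Data.Fin.Properties using (toℕ-fromℕ<; toℕ-fromℕ; any?; punchIn-injective; punchInᵢ≢i)
  renaming (_≟_ to _≟ᶠ_)
open import Data.Product using (Σ; _×_; _,_; ∃)
open import Data.Product.Properties using (,-injective; ,-injectiveʳ)
open import Data.Sum using (_⊎_; inj₁; inj₂)
open import Data.Sum.Properties using (inj₁-injective)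
open import Data.Unit using (tt)
open import Data.Empty using (⊥; ⊥-elim)
open import Data.List using (List; []; _∷_; _++_; concat; concatMap; allFin; tabulate; map)
open import Data.List.Properties using (map-tabulate; map-++; ++-assoc)
open import Data.List.Membership.Propositional using (_∈_)
open import Data.List.Membership.Propositional.Properties using (∈-++⁺ˡ; ∈-++⁺ʳ; ∈-++⁻; ∈-map⁺; ∈-map⁻)
open import Data.List.Relation.Unary.Any using (here; there)
open import Data.List.Relation.Unary.All using (All; []; _∷_) renaming (lookup to All-lookup; tabulate to All-tabulate)
import Data.List.Relation.Unary.All.Properties as All
import Data.List.Relation.Unary.AllPairs.Properties as AllPairs
open import Data.List.Relation.Unary.Unique.Propositional using (Unique; []; _∷_)
import Data.List.Relation.Unary.Unique.Propositional.Properties as Unique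
open import Data.List.Relation.Binary.Disjoint.Propositional using (Disjoint)
open import Data.List.Relation.Binary.Permutation.Propositional
  using (_↭_; prep; ↭-sym; ↭-reflexive; ↭⇒↭ₛ; module PermutationReasoning)
import Data.List.Relation.Binary.Permutation.Propositional.Properties as Perm
import Data.List.Relation.Binary.Permutation.Setoid.Properties as PermS
open import Relation.Nullary using (Dec; yes; no)
open import Relation.Binary.PropositionalEquality using (_≡_; _≢_; refl; sym; trans; cong; cong₂; subst; setoid; module ≡-Reasoning)

-- Duplicate-free concatenations of finite families of lists

record DisjointFamily {X : Set} {t : ℕ} (g : Fin t → List X) : Set where
  field
    unique   : ∀ i → Unique (g i)
    disjoint : ∀ {i j} → i ≢ j → Disjoint (g i) (g j)

module _ {X : Set} where

  unique-++⁻ : ∀ (xs : List X) {ys} → Unique (xs ++ ys) → Unique xs × Unique ys × Disjoint xs ys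
  unique-++⁻ [] u = [] , u , λ ()
  unique-++⁻ (x ∷ xs) (x∉ ∷ u) with unique-++⁻ xs u
  ... | uxs , uys , dis = All.++⁻ˡ xs x∉ ∷ uxs , uys , disjoint
    where
      disjoint : Disjoint (x ∷ xs) _
      disjoint (here refl , m) = All-lookup (All.++⁻ʳ xs x∉) m refl
      disjoint (there mx , m) = dis (mx , m)

  ∈-concat⁺ : ∀ {t} (g : Fin t → List X) i {x} → x ∈ g i → x ∈ concat (tabulate g)
  ∈-concat⁺ g zero m = ∈-++⁺ˡ m
  ∈-concat⁺ g (suc i) m = ∈-++⁺ʳ (g zero) (∈-concat⁺ (λ j → g (suc j)) i m)

  unique-concat⁻ : ∀ {t} (g : Fin t → List X) → Unique (concat (tabulate g)) → DisjointFamily g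
  unique-concat⁻ {zero} g u = record { unique = λ () ; disjoint = λ { {()} } }
  unique-concat⁻ {suc t} g u with unique-++⁻ (g zero) u
  ... | u₀ , u₊ , dis = record { unique = uniq ; disjoint = disj }
    where
      rest : DisjointFamily (λ i → g (suc i))
      rest = unique-concat⁻ (λ i → g (suc i)) u₊
      uniq : ∀ i → Unique (g i)
      uniq zero = u₀
      uniq (suc i) = DisjointFamily.unique rest i
      disj : ∀ {i j} → i ≢ j → Disjoint (g i) (g j)
      disj {zero} {zero} i≢j _ = i≢j refl
      disj {zero} {suc j} _ (m₀ , mⱼ) = dis (m₀ , ∈-concat⁺ (λ k → g (suc k)) j mⱼ)
      disj {suc i} {zero} _ (mᵢ , m₀) = dis (m₀ , ∈-concat⁺ (λ k → g (suc k)) i mᵢ)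
      disj {suc i} {suc j} i≢j = DisjointFamily.disjoint rest (λ i≡j → i≢j (cong suc i≡j))

  concatMap-allFin : ∀ {t} (g : Fin t → List X) → concatMap g (allFin t) ≡ concat (tabulate g)
  concatMap-allFin g = cong concat (map-tabulate (λ i → i) g)

  family⁻ : ∀ {t} (g : Fin t → List X) → Unique (concatMap g (allFin t)) → DisjointFamily g
  family⁻ g u = unique-concat⁻ g (subst Unique (concatMap-allFin g) u)

  family⁺ : ∀ {t} (g : Fin t → List X) → DisjointFamily g → Unique (concatMap g (allFin t))
  family⁺ g fam = subst Unique (sym (concatMap-allFin g))
    (Unique.concat⁺ (All.tabulate⁺ unique) (AllPairs.tabulate⁺ disjoint))
    where open DisjointFamily fam

-- Booleans, alternation along ℕ, and a cyclic successor on Fin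

-- shade s k: the colour s flipped k times.  Consecutive shades differ,
-- which makes any path coloured by its level properly coloured.
shade : Bool → ℕ → Bool
shade s zero = s
shade s (suc k) = not (shade s k)

≢-≢⇒≡ : ∀ {x y z : Bool} → x ≢ y → x ≢ z → y ≡ z
≢-≢⇒≡ x≢y x≢z = not-injective (trans (sym (¬-not x≢y)) (¬-not x≢z))

alternate : {A : Set} → A → A → ℕ → A
alternate x y zero = x
alternate x y (suc k) = alternate y x k

alternate-edge : (K : Graph) {x y : V K} → E K x y → ∀ k → E K (alternate x y k) (alternate x y (suc k))
alternate-edge K xy zero = xy
alternate-edge K xy (suc k) = alternate-edge K (E-sym K xy) k

alternate-collide : {A : Set} (x y x′ y′ : A) (k : ℕ) → alternate x y k ≡ alternate x′ y′ k → x ≡ x′ ⊎ y ≡ y′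
alternate-collide x y x′ y′ zero eq = inj₁ eq
alternate-collide x y x′ y′ (suc k) eq with alternate-collide y x y′ x′ k eq
... | inj₁ y≡y′ = inj₂ y≡y′
... | inj₂ x≡x′ = inj₁ x≡x′

-- The cyclic successor i ↦ i + 1 (mod m + 1): an injection which, as soon as
-- there are two elements, has no fixed point.  It pairs every branch set of a
-- minor with a different one.
next : ∀ {m} → Fin (suc m) → Fin (suc m)
next {zero} zero = zero
next {suc m} zero = suc zero
next {suc m} (suc i) = punchIn (suc zero) (next i)

next-injective : ∀ {m} {i j : Fin (suc m)} → next i ≡ next j → i ≡ j
next-injective {zero} {zero} {zero} _ = refl
next-injective {suc m} {zero} {zero} _ = refl
next-injective {suc m} {zero} {suc j} eq = ⊥-elim (punchInᵢ≢i (suc zero) (next j) (sym eq))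
next-injective {suc m} {suc i} {zero} eq = ⊥-elim (punchInᵢ≢i (suc zero) (next i) eq)
next-injective {suc m} {suc i} {suc j} eq =
  cong suc (next-injective (punchIn-injective (suc zero) (next i) (next j) eq))

next-no-fixed-point : ∀ {m} (i : Fin (suc (suc m))) → next i ≢ i
next-no-fixed-point zero ()
next-no-fixed-point {zero} (suc zero) ()
next-no-fixed-point {suc m} (suc i) eq = next-no-fixed-point i (punchIn-one (next i) i eq)
  where
    punchIn-one : ∀ {k} (x y : Fin (suc k)) → punchIn (suc zero) x ≡ suc y → x ≡ y
    punchIn-one (suc x) .(suc x) refl = refl

-- Rooted subtrees of a graph: positions, grafting, and images under maps

module Trees (K : Graph) where

  Children : V K → Set
  Children v = List (Σ (V K) λ w → E K v w × Tree K w)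

  children : ∀ {v} → Tree K v → Children v
  children (node _ cs) = cs

  verts-node : ∀ {v} (T : Tree K v) → verts K T ≡ v ∷ vertsF K (children T)
  verts-node (node _ _) = refl

  proper-children : ∀ {c v} (T : Tree K v) → Proper K c T → ProperF K c v (children T)
  proper-children (node _ _) pr = pr

  leaf-verts : ∀ {a} (T : Tree K a) → children T ≡ [] → ∀ {x} → x ∈ verts K T → x ≡ a
  leaf-verts (node a []) _ (here refl) = refl

  vertsF-++ : ∀ {v} (xs ys : Children v) → vertsF K (xs ++ ys) ≡ vertsF K xs ++ vertsF K ys
  vertsF-++ [] ys = refl
  vertsF-++ ((_ , _ , t) ∷ xs) ys = begin
    verts K t ++ vertsF K (xs ++ ys)          ≡⟨ cong (verts K t ++_) (vertsF-++ xs ys) ⟩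
    verts K t ++ (vertsF K xs ++ vertsF K ys) ≡⟨ sym (++-assoc (verts K t) _ _) ⟩
    (verts K t ++ vertsF K xs) ++ vertsF K ys ∎
    where open ≡-Reasoning

  properF-++ : ∀ {c v} (xs ys : Children v) → ProperF K c v xs → ProperF K c v ys → ProperF K c v (xs ++ ys)
  properF-++ [] ys _ pys = pys
  properF-++ (_ ∷ xs) ys (neq , pt , pxs) pys = neq , pt , properF-++ xs ys pxs pys

  mutual
    data At : ∀ {v} → Tree K v → V K → Set where
      root  : ∀ {v cs} → At (node v cs) v
      below : ∀ {v cs p} → AtF {v} cs p → At (node v cs) p

    data AtF {v : V K} : Children v → V K → Set where
      first : ∀ {w e t cs p} → At t p → AtF ((w , e , t) ∷ cs) p
      later : ∀ {c cs p} → AtF cs p → AtF (c ∷ cs) p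

  mutual
    At⇒∈ : ∀ {v p} {T : Tree K v} → At T p → p ∈ verts K T
    At⇒∈ root = here refl
    At⇒∈ (below a) = there (AtF⇒∈ a)

    AtF⇒∈ : ∀ {v p} {cs : Children v} → AtF cs p → p ∈ vertsF K cs
    AtF⇒∈ (first a) = ∈-++⁺ˡ (At⇒∈ a)
    AtF⇒∈ {cs = (_ , _ , t) ∷ _} (later a) = ∈-++⁺ʳ (verts K t) (AtF⇒∈ a)

  mutual
    graft : ∀ {v p} (T : Tree K v) → At T p → Children p → Tree K v
    graft (node v cs) root X = node v (cs ++ X)
    graft (node v cs) (below a) X = node v (graftF cs a X)

    graftF : ∀ {v p} (cs : Children v) → AtF cs p → Children p → Children v
    graftF ((w , e , t) ∷ cs) (first a) X = (w , e , graft t a X) ∷ cs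
    graftF (c ∷ cs) (later a) X = c ∷ graftF cs a X

  mutual
    verts-graft : ∀ {v p} (T : Tree K v) (a : At T p) X →
                  verts K (graft T a X) ↭ verts K T ++ vertsF K X
    verts-graft (node v cs) root X = ↭-reflexive (cong (v ∷_) (vertsF-++ cs X))
    verts-graft (node v cs) (below a) X = prep v (vertsF-graft cs a X)

    vertsF-graft : ∀ {v p} (cs : Children v) (a : AtF cs p) X →
                   vertsF K (graftF cs a X) ↭ vertsF K cs ++ vertsF K X
    vertsF-graft ((_ , _ , t) ∷ cs) (first a) X = begin
      verts K (graft t a X) ++ vertsF K cs       ↭⟨ Perm.++⁺ʳ (vertsF K cs) (verts-graft t a X) ⟩
      (verts K t ++ vertsF K X) ++ vertsF K cs   ≡⟨ ++-assoc (verts K t) _ _ ⟩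
      verts K t ++ (vertsF K X ++ vertsF K cs)   ↭⟨ Perm.++⁺ˡ (verts K t) (Perm.++-comm (vertsF K X) _) ⟩
      verts K t ++ (vertsF K cs ++ vertsF K X)   ≡⟨ sym (++-assoc (verts K t) _ _) ⟩
      (verts K t ++ vertsF K cs) ++ vertsF K X   ∎
      where open PermutationReasoning
    vertsF-graft ((_ , _ , t) ∷ cs) (later a) X = begin
      verts K t ++ vertsF K (graftF cs a X)      ↭⟨ Perm.++⁺ˡ (verts K t) (vertsF-graft cs a X) ⟩
      verts K t ++ (vertsF K cs ++ vertsF K X)   ≡⟨ sym (++-assoc (verts K t) _ _) ⟩
      (verts K t ++ vertsF K cs) ++ vertsF K X   ∎
      where open PermutationReasoning

  mutual
    proper-graft : ∀ {c v p} (T : Tree K v) (a : At T p) X →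
                   Proper K c T → ProperF K c p X → Proper K c (graft T a X)
    proper-graft (node v cs) root X pT pX = properF-++ cs X pT pX
    proper-graft (node v cs) (below a) X pT pX = properF-graft cs a X pT pX

    properF-graft : ∀ {c v p} (cs : Children v) (a : AtF cs p) X →
                    ProperF K c v cs → ProperF K c p X → ProperF K c v (graftF cs a X)
    properF-graft ((_ , _ , t) ∷ cs) (first a) X (neq , pt , pcs) pX = neq , proper-graft t a X pt pX , pcs
    properF-graft (_ ∷ cs) (later a) X (neq , pt , pcs) pX = neq , pt , properF-graft cs a X pcs pX

module MapTrees {K L : Graph} (φ : V K → V L) (φ-edge : ∀ {u v} → E K u v → E L (φ u) (φ v)) where
  private
    module TK = Trees K
    module TL = Trees L

  mutual
    mapTree : ∀ {v} → Tree K v → Tree L (φ v)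
    mapTree (node v cs) = node (φ v) (mapF cs)

    mapF : ∀ {v} → TK.Children v → TL.Children (φ v)
    mapF [] = []
    mapF ((w , e , t) ∷ cs) = (φ w , φ-edge e , mapTree t) ∷ mapF cs

  mutual
    verts-map : ∀ {v} (T : Tree K v) → verts L (mapTree T) ≡ map φ (verts K T)
    verts-map (node v cs) = cong (φ v ∷_) (vertsF-map cs)

    vertsF-map : ∀ {v} (cs : TK.Children v) → vertsF L (mapF cs) ≡ map φ (vertsF K cs)
    vertsF-map [] = refl
    vertsF-map ((_ , _ , t) ∷ cs) = begin
      verts L (mapTree t) ++ vertsF L (mapF cs)  ≡⟨ cong₂ _++_ (verts-map t) (vertsF-map cs) ⟩
      map φ (verts K t) ++ map φ (vertsF K cs)   ≡⟨ sym (map-++ φ (verts K t) _) ⟩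
      map φ (verts K t ++ vertsF K cs)           ∎
      where open ≡-Reasoning

  module _ {c : V K → Bool} {c′ : V L → Bool} (pullback : ∀ u → c′ (φ u) ≡ c u) where
    mutual
      proper-map : ∀ {v} (T : Tree K v) → Proper K c T → Proper L c′ (mapTree T)
      proper-map (node v cs) pr = properF-map cs pr

      properF-map : ∀ {v} (cs : TK.Children v) → ProperF K c v cs → ProperF L c′ (φ v) (mapF cs)
      properF-map [] _ = tt
      properF-map {v} ((w , _ , t) ∷ cs) (neq , pt , pcs) =
        (λ eq → neq (trans (sym (pullback v)) (trans eq (pullback w)))) , proper-map t pt , properF-map cs pcs

  mutual
    At-map : ∀ {v p} {T : Tree K v} → TK.At T p → TL.At (mapTree T) (φ p)
    At-map TK.root = TL.root
    At-map (TK.below a) = TL.below (AtF-map a)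

    AtF-map : ∀ {v p} {cs : TK.Children v} → TK.AtF cs p → TL.AtF (mapF cs) (φ p)
    AtF-map (TK.first a) = TL.first (At-map a)
    AtF-map (TK.later a) = TL.later (AtF-map a)

-- The generalized Mycielskian M_{n+1}(G): level-0 copy and zigzag ascents

module Mycielski (G : Graph) (n : ℕ) where

  H : Graph
  H = Mycielskian (suc n) G

  MVert : Set
  MVert = MV G (suc n)

  apex : MVert
  apex = inj₂ tt

  base : V G → MVert
  base u = inj₁ (u , zero)

  base-edge : ∀ {u v} → E G u v → E H (base u) (base v)
  base-edge e = e , inj₂ (refl , refl)

  base-injective : ∀ {u v} → base u ≡ base v → u ≡ v
  base-injective refl = refl

  base-not-above : ∀ {u w} {k : Fin (suc n)} → 0 < toℕ k → base u ≢ inj₁ (w , k)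
  base-not-above {k = suc _} _ ()

  colouring : (V G → Bool) → Bool → MVert → Bool
  colouring c s (inj₁ (u , zero)) = c u
  colouring c s (inj₁ (u , suc j)) = shade s (suc (toℕ j))
  colouring c s (inj₂ _) = shade s n

  module Zigzag {p q : V G} (pq : E G p q) where

    pt : Fin (suc n) → MVert
    pt j = inj₁ (alternate p q (toℕ j) , j)

    up : (j : Fin (suc n)) → toℕ j < n → Fin (suc n)
    up j j<n = suc (fromℕ< j<n)

    toℕ-up : ∀ j (j<n : toℕ j < n) → toℕ (up j j<n) ≡ suc (toℕ j)
    toℕ-up j j<n = cong suc (toℕ-fromℕ< j<n)

    up-edge : ∀ j (j<n : toℕ j < n) → E H (pt j) (pt (up j j<n))
    up-edge j j<n =
      subst (λ k → E G (alternate p q (toℕ j)) (alternate p q k)) (sym (toℕ-up j j<n))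
            (alternate-edge G pq (toℕ j)) ,
      inj₁ (inj₂ (toℕ-up j j<n))

    below-top : ∀ m (j : Fin (suc n)) → toℕ j + suc m ≡ n → toℕ j < n
    below-top m j eq = subst (toℕ j <_) eq (m<m+n (toℕ j) (s≤s z≤n))

    up-remaining : ∀ m (j : Fin (suc n)) (eq : toℕ j + suc m ≡ n) → toℕ (up j (below-top m j eq)) + m ≡ n
    up-remaining m j eq = trans (cong (_+ m) (toℕ-up j (below-top m j eq))) (trans (sym (+-suc (toℕ j) m)) eq)

    climb : ∀ m (j : Fin (suc n)) → toℕ j + m ≡ n → Tree H (pt j)
    climb zero j _ = node (pt j) []
    climb (suc m) j eq =
      node (pt j) ((pt (up j j<n) , up-edge j j<n , climb m (up j j<n) (up-remaining m j eq)) ∷ [])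
      where
        j<n : toℕ j < n
        j<n = below-top m j eq

    mutual
      climb-verts : ∀ m j eq {v} → v ∈ verts H (climb m j eq) → ∃ λ k → toℕ j ≤ toℕ k × v ≡ pt k
      climb-verts zero j eq (here refl) = j , ≤-refl , refl
      climb-verts (suc m) j eq (here refl) = j , ≤-refl , refl
      climb-verts (suc m) j eq (there v∈) with climb-verts-above (suc m) j eq v∈
      ... | k , j<k , refl = k , <⇒≤ j<k , refl

      climb-verts-above : ∀ m j eq {v} → v ∈ vertsF H (Trees.children H (climb m j eq)) →
                          ∃ λ k → toℕ j < toℕ k × v ≡ pt k
      climb-verts-above (suc m) j eq v∈ with ∈-++⁻ (verts H (climb m _ _)) v∈
      ... | inj₁ v∈′ with climb-verts m _ _ v∈′
      ...   | k , j′≤k , refl = k , subst (_≤ toℕ k) (toℕ-up j (below-top m j eq)) j′≤k , refl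

    -- The climb visits each level once, so it repeats no vertex.
    climb-unique : ∀ m j eq → Unique (verts H (climb m j eq))
    climb-unique zero j eq = [] ∷ []
    climb-unique (suc m) j eq =
      All-tabulate root-new ∷ Unique.++⁺ (climb-unique m _ _) [] (λ ())
      where
        root-new : ∀ {v} → v ∈ verts H (climb m _ _) ++ [] → pt j ≢ v
        root-new v∈ refl with climb-verts-above (suc m) j eq v∈
        ... | k , j<k , eq′ = <⇒≢ j<k (cong toℕ (,-injectiveʳ (inj₁-injective eq′)))

    climb-top : ∀ m j eq → ∃ λ k → pt k ∈ verts H (climb m j eq) × toℕ k ≡ n
    climb-top zero j eq = j , here refl , trans (sym (+-identityʳ (toℕ j))) eq
    climb-top (suc m) j eq with climb-top m _ _
    ... | k , k∈ , top = k , there (∈-++⁺ˡ k∈) , top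

    zigzag : Tree H (base p)
    zigzag = climb n zero refl

    ascent : Trees.Children H (base p)
    ascent = Trees.children H zigzag

    ascent-verts : ∀ {v} → v ∈ vertsF H ascent → ∃ λ k → 0 < toℕ k × v ≡ pt k
    ascent-verts = climb-verts-above n zero refl

    ascent-unique : Unique (vertsF H ascent)
    ascent-unique with subst Unique (Trees.verts-node H zigzag) (climb-unique n zero refl)
    ... | _ ∷ u = u

    module _ {c : V G → Bool} {s : Bool} (p-shade : c p ≡ s) where

      colouring-pt : ∀ j → colouring c s (pt j) ≡ shade s (toℕ j)
      colouring-pt zero = p-shade
      colouring-pt (suc j) = refl

      climb-proper : ∀ m j eq → Proper H (colouring c s) (climb m j eq)
      climb-proper zero j eq = tt
      climb-proper (suc m) j eq = differ , climb-proper m _ _ , tt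
        where
          j<n : toℕ j < n
          j<n = below-top m j eq
          differ : colouring c s (pt j) ≢ colouring c s (pt (up j j<n))
          differ eq′ = not-¬ refl (trans (sym (colouring-pt j))
                         (trans eq′ (trans (colouring-pt (up j j<n)) (cong (shade s) (toℕ-up j j<n)))))

      ascent-proper : ProperF H (colouring c s) (base p) ascent
      ascent-proper = Trees.proper-children H zigzag (climb-proper n zero refl)

oddK₂ : (G : Graph) (n : ℕ) → V G → OddMinor (Mycielskian (suc n) G) 2
oddK₂ G n a = record
  { root = branch
  ; tree = λ i → node (branch i) []
  ; disjoint = ((λ ()) ∷ []) ∷ [] ∷ []
  ; colour = λ _ → true
  ; proper = λ _ → tt
  ; link = link
  }
  where
    open Mycielski G n using (MVert; apex)
    top-adj : suc (toℕ (fromℕ n)) ≡ suc n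
    top-adj = cong suc (toℕ-fromℕ n)
    branch : Fin 2 → MVert
    branch zero = apex
    branch (suc _) = inj₁ (a , fromℕ n)
    link : (i j : Fin 2) → i ≢ j → Σ MVert λ x → Σ MVert λ y →
           (x ∈ branch i ∷ []) × (y ∈ branch j ∷ []) × ME G (suc n) x y × (true ≡ true)
    link zero zero 0≢0 = ⊥-elim (0≢0 refl)
    link zero (suc zero) _ = apex , branch (suc zero) , here refl , here refl , top-adj , refl
    link (suc zero) zero _ = branch (suc zero) , apex , here refl , here refl , top-adj , refl
    link (suc zero) (suc zero) 1≢1 = ⊥-elim (1≢1 refl)

-- Anchors: where the ascent to the apex is attached to a branch tree

module Anchors (G : Graph) (c : V G → Bool) (s : Bool) where
  open Trees G

  -- The zigzag along pq will climb
  -- from p; the position of q keeps zigzags of different trees disjoint.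
  record Anchor {a} (T : Tree G a) (O : List (V G)) : Set where
    field
      p q     : V G
      pq      : E G p q
      at      : At T p
      p-shade : c p ≡ s
      q-place : (q ∈ O × c q ≡ s) ⊎ (q ∈ verts G T × c q ≡ not s)

  -- Every properly coloured tree with an edge has an anchor: its root if
  -- the root has colour s, otherwise its first child.
  anchor : ∀ {a} (T : Tree G a) {O} → Proper G c T →
           (children T ≡ [] → c a ≡ s × ∃ λ q → E G a q × q ∈ O × c q ≡ s) → Anchor T O
  anchor (node a []) _ leaf with leaf refl
  ... | ca , q , aq , q∈ , cq = record
    { p = a ; q = q ; pq = aq ; at = root ; p-shade = ca ; q-place = inj₁ (q∈ , cq) }
  anchor (node a ((b , ab , node _ _) ∷ _)) (a≢b , _) _ with c a ≟ᵇ s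
  ... | yes ca = record
    { p = a ; q = b ; pq = ab ; at = root ; p-shade = ca
    ; q-place = inj₂ (there (here refl) , trans (¬-not (λ eq → a≢b (sym eq))) (cong not ca)) }
  ... | no ¬ca = record
    { p = b ; q = a ; pq = E-sym G ab ; at = below (first root)
    ; p-shade = ≢-≢⇒≡ a≢b ¬ca ; q-place = inj₂ (here refl , ¬-not ¬ca) }

-- The odd K_{t+1} minor of M_{n+1}(G) built from an odd K_t minor, t ≥ 2

module Construction (G : Graph) (t′ n : ℕ) (minor : OddMinor G (suc (suc t′))) where
  open OddMinor minor
  open Mycielski G n
  open MapTrees {G} {H} base base-edge using (mapTree; verts-map; proper-map; At-map)
  open Anchors G colour

  t : ℕ
  t = suc (suc t′)

  Leaf : Fin t → Set
  Leaf i = Trees.children G (tree i) ≡ []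

  leaf? : ∀ i → Dec (Leaf i)
  leaf? i = empty? (Trees.children G (tree i))
    where
      empty? : ∀ {A : Set} (xs : List A) → Dec (xs ≡ [])
      empty? [] = yes refl
      empty? (_ ∷ _) = no (λ ())

  -- Single-vertex branch sets are joined by monochromatic edges, so their
  -- roots all have the same colour.
  leaf-colours : ∀ i j → Leaf i → Leaf j → colour (root i) ≡ colour (root j)
  leaf-colours i j leafᵢ leafⱼ with i ≟ᶠ j
  ... | yes refl = refl
  ... | no i≢j with link i j i≢j
  ...   | x , y , x∈ , y∈ , _ , same =
    trans (cong colour (sym (Trees.leaf-verts G (tree i) leafᵢ x∈)))
          (trans same (cong colour (Trees.leaf-verts G (tree j) leafⱼ y∈)))

  -- The shade s of level 0 along the ascents: the colour of the single-vertex
  -- branch sets if there are any.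
  leafColour : Dec (∃ Leaf) → Bool
  leafColour (yes (j , _)) = colour (root j)
  leafColour (no _) = true

  s : Bool
  s = leafColour (any? leaf?)

  leaf-shade : ∀ i → Leaf i → colour (root i) ≡ s
  leaf-shade i leafᵢ = agree (any? leaf?)
    where
      agree : ∀ d → colour (root i) ≡ leafColour d
      agree (yes (j , leafⱼ)) = leaf-colours i j leafᵢ leafⱼ
      agree (no none) = ⊥-elim (none (i , leafᵢ))

  -- Every branch tree has an anchor; a single-vertex one uses its
  -- monochromatic edge to the next branch set.
  anchorOf : ∀ i → Anchor s (tree i) (verts G (tree (next i)))
  anchorOf i = anchor s (tree i) (proper i) leaf-case
    where
      leaf-case : Leaf i → colour (root i) ≡ s × ∃ λ q → E G (root i) q × q ∈ verts G (tree (next i)) × colour q ≡ s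
      leaf-case leafᵢ with link i (next i) (λ eq → next-no-fixed-point i (sym eq))
      ... | x , y , x∈ , y∈ , xy , same =
        leaf-shade i leafᵢ , y , subst (λ w → E G w y) x≡root xy , y∈ ,
        trans (sym same) (trans (cong colour x≡root) (leaf-shade i leafᵢ))
        where
          x≡root : x ≡ root i
          x≡root = Trees.leaf-verts G (tree i) leafᵢ x∈

  module A (i : Fin t) = Anchor s (anchorOf i)
  module Z (i : Fin t) = Zigzag (A.pq i)

  colour′ : MVert → Bool
  colour′ = colouring colour s

  newTree : ∀ i → Tree H (base (root i))
  newTree i = Trees.graft H (mapTree (tree i)) (At-map (A.at i)) (Z.ascent i)

  newTree-verts : ∀ i → verts H (newTree i) ↭ map base (verts G (tree i)) ++ vertsF H (Z.ascent i)
  newTree-verts i = begin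
    verts H (newTree i)                                     ↭⟨ Trees.verts-graft H _ (At-map (A.at i)) _ ⟩
    verts H (mapTree (tree i)) ++ vertsF H (Z.ascent i)     ≡⟨ cong (_++ vertsF H (Z.ascent i)) (verts-map (tree i)) ⟩
    map base (verts G (tree i)) ++ vertsF H (Z.ascent i)    ∎
    where open PermutationReasoning

  base-∈ : ∀ i {u} → u ∈ verts G (tree i) → base u ∈ verts H (newTree i)
  base-∈ i u∈ = Perm.∈-resp-↭ (↭-sym (newTree-verts i)) (∈-++⁺ˡ (∈-map⁺ base u∈))

  ascent-∈ : ∀ i {v} → v ∈ vertsF H (Z.ascent i) → v ∈ verts H (newTree i)
  ascent-∈ i v∈ = Perm.∈-resp-↭ (↭-sym (newTree-verts i)) (∈-++⁺ʳ (map base (verts G (tree i))) v∈)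

  zigzag-∈ : ∀ i {v} → v ∈ verts H (Z.zigzag i) → v ∈ verts H (newTree i)
  zigzag-∈ i v∈ with subst (_ ∈_) (Trees.verts-node H (Z.zigzag i)) v∈
  ... | here refl = base-∈ i (Trees.At⇒∈ G (A.at i))
  ... | there v∈′ = ascent-∈ i v∈′

  newTree-classify : ∀ i {v} → v ∈ verts H (newTree i) →
                     (∃ λ u → u ∈ verts G (tree i) × v ≡ base u) ⊎ (∃ λ k → 0 < toℕ k × v ≡ Z.pt i k)
  newTree-classify i v∈ with ∈-++⁻ (map base (verts G (tree i))) (Perm.∈-resp-↭ (newTree-verts i) v∈)
  ... | inj₁ v∈base = inj₁ (∈-map⁻ base v∈base)
  ... | inj₂ v∈ascent = inj₂ (Z.ascent-verts i v∈ascent)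

  branchSets : DisjointFamily (λ i → verts G (tree i))
  branchSets = family⁻ (λ i → verts G (tree i)) disjoint

  -- A new tree repeats no vertex: the copy and the ascent live on different levels.
  newTree-unique : ∀ i → Unique (verts H (newTree i))
  newTree-unique i = PermS.Unique-resp-↭ (setoid MVert) (↭⇒↭ₛ (↭-sym (newTree-verts i)))
    (Unique.++⁺ (Unique.map⁺ base-injective (DisjointFamily.unique branchSets i)) (Z.ascent-unique i) apart)
    where
      apart : Disjoint (map base (verts G (tree i))) (vertsF H (Z.ascent i))
      apart (v∈base , v∈ascent) with ∈-map⁻ base v∈base | Z.ascent-verts i v∈ascent
      ... | _ , _ , refl | _ , 0<k , eq = base-not-above 0<k eq

  -- The second endpoints of different anchors differ: either both lie in
  -- distinct branch sets (next is injective), or their colours differ.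
  anchor-q-distinct : ∀ {i j} → i ≢ j → A.q i ≢ A.q j
  anchor-q-distinct {i} {j} i≢j q≡ with A.q-place i | A.q-place j
  ... | inj₁ (qᵢ∈ , _) | inj₁ (qⱼ∈ , _) =
    DisjointFamily.disjoint branchSets (λ eq → i≢j (next-injective eq)) (qᵢ∈ , subst (_∈ _) (sym q≡) qⱼ∈)
  ... | inj₁ (_ , cqᵢ) | inj₂ (_ , cqⱼ) = not-¬ refl (trans (sym cqᵢ) (trans (cong colour q≡) cqⱼ))
  ... | inj₂ (_ , cqᵢ) | inj₁ (_ , cqⱼ) = not-¬ refl (trans (sym cqⱼ) (trans (cong colour (sym q≡)) cqᵢ))
  ... | inj₂ (qᵢ∈ , _) | inj₂ (qⱼ∈ , _) =
    DisjointFamily.disjoint branchSets i≢j (qᵢ∈ , subst (_∈ _) (sym q≡) qⱼ∈)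

  zigzags-apart : ∀ {i j} → i ≢ j → ∀ k k′ → Z.pt i k ≢ Z.pt j k′
  zigzags-apart {i} {j} i≢j k k′ eq with ,-injective (inj₁-injective eq)
  ... | same , refl with alternate-collide (A.p i) (A.q i) (A.p j) (A.q j) (toℕ k) same
  ...   | inj₁ p≡ = DisjointFamily.disjoint branchSets i≢j
                      (Trees.At⇒∈ G (A.at i) , subst (_∈ _) (sym p≡) (Trees.At⇒∈ G (A.at j)))
  ...   | inj₂ q≡ = anchor-q-distinct i≢j q≡

  newTree-disjoint : ∀ {i j} → i ≢ j → Disjoint (verts H (newTree i)) (verts H (newTree j))
  newTree-disjoint {i} {j} i≢j (v∈ᵢ , v∈ⱼ) with newTree-classify i v∈ᵢ | newTree-classify j v∈ⱼ
  ... | inj₁ (u , u∈ , refl) | inj₁ (w , w∈ , eq) =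
    DisjointFamily.disjoint branchSets i≢j (u∈ , subst (_∈ _) (sym (base-injective eq)) w∈)
  ... | inj₁ (_ , _ , refl) | inj₂ (_ , 0<k , eq) = base-not-above 0<k eq
  ... | inj₂ (_ , 0<k , refl) | inj₁ (_ , _ , eq) = base-not-above 0<k (sym eq)
  ... | inj₂ (k , _ , refl) | inj₂ (k′ , _ , eq) = zigzags-apart i≢j k k′ eq

  apex-∉ : ∀ i → apex ∈ verts H (newTree i) → ⊥
  apex-∉ i apex∈ with newTree-classify i apex∈
  ... | inj₁ (_ , _ , ())
  ... | inj₂ (_ , _ , ())

  apex-link : ∀ i → Σ MVert λ v → v ∈ verts H (newTree i) × E H v apex × colour′ v ≡ colour′ apex
  apex-link i with Z.climb-top i n zero refl
  ... | k , k∈ , top = Z.pt i k , zigzag-∈ i k∈ , cong suc top ,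
                       trans (Z.colouring-pt i (A.p-shade i) k) (cong (shade s) top)

  root′ : Fin (suc t) → MVert
  root′ zero = apex
  root′ (suc i) = base (root i)

  tree′ : ∀ i → Tree H (root′ i)
  tree′ zero = node apex []
  tree′ (suc i) = newTree i

  newBranchSets : DisjointFamily (λ i → verts H (tree′ i))
  newBranchSets = record { unique = unique′ ; disjoint = disjoint′ }
    where
      unique′ : ∀ i → Unique (verts H (tree′ i))
      unique′ zero = [] ∷ []
      unique′ (suc i) = newTree-unique i
      disjoint′ : ∀ {i j} → i ≢ j → Disjoint (verts H (tree′ i)) (verts H (tree′ j))
      disjoint′ {zero} {zero} 0≢0 _ = 0≢0 refl
      disjoint′ {zero} {suc j} _ (here refl , apex∈) = apex-∉ j apex∈
      disjoint′ {suc i} {zero} _ (apex∈ , here refl) = apex-∉ i apex∈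
      disjoint′ {suc i} {suc j} i≢j = newTree-disjoint (λ eq → i≢j (cong suc eq))

  -- Copies stay proper (colour′ is c on level 0) and ascents are proper.
  proper′ : ∀ i → Proper H colour′ (tree′ i)
  proper′ zero = tt
  proper′ (suc i) = Trees.proper-graft H (mapTree (tree i)) (At-map (A.at i)) (Z.ascent i)
                      (proper-map (λ _ → refl) (tree i) (proper i)) (Z.ascent-proper i (A.p-shade i))

  link′ : ∀ i j → i ≢ j → Σ MVert λ x → Σ MVert λ y →
          (x ∈ verts H (tree′ i)) × (y ∈ verts H (tree′ j)) × E H x y × (colour′ x ≡ colour′ y)
  link′ zero zero 0≢0 = ⊥-elim (0≢0 refl)
  link′ zero (suc j) _ =
    let v , v∈ , v-apex , same = apex-link j
    in apex , v , here refl , v∈ , E-sym H {v} {apex} v-apex , sym same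
  link′ (suc i) zero _ =
    let v , v∈ , v-apex , same = apex-link i
    in v , apex , v∈ , here refl , v-apex , same
  link′ (suc i) (suc j) i≢j =
    let x , y , x∈ , y∈ , xy , same = link i j (λ eq → i≢j (cong suc eq))
    in base x , base y , base-∈ i x∈ , base-∈ j y∈ , base-edge xy , same

  oddMinor : OddMinor H (suc t)
  oddMinor = record
    { root = root′
    ; tree = tree′
    ; disjoint = family⁺ (λ i → verts H (tree′ i)) newBranchSets
    ; colour = colour′
    ; proper = proper′
    ; link = link′
    }

proposition1 : (G : Graph) → Finite G → (t : ℕ) → 1 ≤ t →
    OddMinor G t → (r : ℕ) → 1 ≤ r → OddMinor (Mycielskian r G) (suc t)
proposition1 G _ (suc zero) _ minor (suc n) _ = oddK₂ G n (OddMinor.root minor zero)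
proposition1 G _ (suc (suc t′)) _ minor (suc n) _ = Construction.oddMinor G t′ n minor
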